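{- The following equations are derivable by equational logic from $\mathrm{EqFSCL}$: (1) $(x \vee^{\circ} \mathsf{T}) \wedge^{\circ} \neg y = \neg((x \vee^{\circ} \mathsf{T}) \wedge^{\circ} y)$; (2) $(x \wedge^{\circ} (y \wedge^{\circ} (z \vee^{\circ} \mathsf{T}))) \vee^{\circ} (w \wedge^{\circ} (z \vee^{\circ} \mathsf{T})) = ((x \wedge^{\circ} y) \vee^{\circ} w) \wedge^{\circ} (z \vee^{\circ} \mathsf{T})$; (3) $(x \vee^{\circ} ((y \vee^{\circ} \mathsf{T}) \wedge^{\circ} (z \wedge^{\circ} \mathsf{F}))) \wedge^{\circ} ((w \vee^{\circ} \mathsf{T}) \wedge^{\circ} (z \wedge^{\circ} \mathsf{F})) = ((x \wedge^{\circ} (w \vee^{\circ} \mathsf{T})) \vee^{\circ} (y \vee^{\circ} \mathsf{T})) \wedge^{\circ} (z \wedge^{\circ} \mathsf{F})$; (4) $(x \vee^{\circ} ((y \vee^{\circ} \mathsf{T}) \wedge^{\circ} (z \wedge^{\circ} \mathsf{F}))) \wedge^{\circ} (w \wedge^{\circ} \mathsf{F}) = ((\neg x \wedge^{\circ} (y \vee^{\circ} \mathsf{T})) \vee^{\circ} (w \wedge^{\circ} \mathsf{F})) \wedge^{\circ} (z \wedge^{\circ} \mathsf{F})$.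
   Context: Terms are built from variables, constants $\mathsf{T}, \mathsf{F}$, negation $\neg$, and binary connectives $\wedge^{\circ}$ (short-circuit left-sequential conjunction) and $\vee^{\circ}$ (short-circuit left-sequential disjunction). $\mathrm{EqFSCL}$ is the set of equations: $\mathsf{F} = \neg\mathsf{T}$; $x \vee^{\circ} y = \neg(\neg x \wedge^{\circ} \neg y)$; $\neg\neg x = x$; $(x \wedge^{\circ} y) \wedge^{\circ} z = x \wedge^{\circ} (y \wedge^{\circ} z)$; $\mathsf{T} \wedge^{\circ} x = x$; $x \wedge^{\circ} \mathsf{T} = x$; $\mathsf{F} \wedge^{\circ} x = \mathsf{F}$; $x \wedge^{\circ} \mathsf{F} = \neg x \wedge^{\circ} \mathsf{F}$; $(x \wedge^{\circ} \mathsf{F}) \vee^{\circ} y = (x \vee^{\circ} \mathsf{T}) \wedge^{\circ} y$; $(x \wedge^{\circ} y) \vee^{\circ} (z \wedge^{\circ} \mathsf{F}) = (x \vee^{\circ} (z \wedge^{\circ} \mathsf{F})) \wedge^{\circ} (y \vee^{\circ} (z \wedge^{\circ} \mathsf{F}))$. -}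

module Defs where

open import Data.Nat using (ℕ)

data Term : Set where
  var  : ℕ → Term
  T F  : Term
  ¬_   : Term → Term
  _∧◦_ : Term → Term → Term
  _∨◦_ : Term → Term → Term

infix  9 ¬_
infixr 7 _∧◦_
infixr 6 _∨◦_
infix  4 _≈_

-- Axiom rules are schemas
-- over arbitrary terms (= closure under substitution); together with
-- reflexivity, symmetry, transitivity and congruence this is exactly
-- equational-logic derivability.
data _≈_ : Term → Term → Set where
  ax1  : F ≈ ¬ T
  ax2  : ∀ x y → x ∨◦ y ≈ ¬ (¬ x ∧◦ ¬ y)
  ax3  : ∀ x → ¬ ¬ x ≈ x
  ax4  : ∀ x y z → (x ∧◦ y) ∧◦ z ≈ x ∧◦ (y ∧◦ z)
  ax5  : ∀ x → T ∧◦ x ≈ x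
  ax6  : ∀ x → x ∧◦ T ≈ x
  ax7  : ∀ x → F ∧◦ x ≈ F
  ax8  : ∀ x → x ∧◦ F ≈ ¬ x ∧◦ F
  ax9  : ∀ x y → (x ∧◦ F) ∨◦ y ≈ (x ∨◦ T) ∧◦ y
  ax10 : ∀ x y z → (x ∧◦ y) ∨◦ (z ∧◦ F)
                   ≈ (x ∨◦ (z ∧◦ F)) ∧◦ (y ∨◦ (z ∧◦ F))
  refl′  : ∀ {s} → s ≈ s
  sym′   : ∀ {s t} → s ≈ t → t ≈ s
  trans′ : ∀ {s t u} → s ≈ t → t ≈ u → s ≈ u
  cong¬  : ∀ {s t} → s ≈ t → ¬ s ≈ ¬ t
  cong∧  : ∀ {s s′ t t′} → s ≈ s′ → t ≈ t′ → s ∧◦ t ≈ s′ ∧◦ t′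
  cong∨  : ∀ {s s′ t t′} → s ≈ s′ → t ≈ t′ → s ∨◦ t ≈ s′ ∨◦ t′

module Submission where

-- Write "a ∧◦ F" for an F-tagged and "a ∨◦ T" for a T-tagged term:
-- both evaluate a for its side effects and then return a fixed value.
--  * Negation: double negation and the duality axiom give the De Morgan
--    laws and ∨◦-associativity, and make the two tags each other's
--    negation, ¬ (a ∧◦ F) ≈ a ∨◦ T.
--  * Tags: an F-tagged term absorbs whatever follows it under ∧◦, a
--    T-tagged term absorbs whatever follows it under ∨◦, and re-tagging
--    a tagged term simply discards the old tag.
--  * Distribution: axiom 10 lets ∨◦ distribute over ∧◦ towards an F-tagged
--    right argument; dually, ∧◦ distributes over ∨◦ towards a T-tagged one.
--  * Behind a final F only side effects matter: the right operand of ∨◦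
--    may be replaced by any term with the same F-tagged form, and a
--    disjunction a ∨◦ (e ∧◦ F) followed by w ∧◦ F can exchange e and w.
-- Equation (1) is a direct computation, (2) is the dual distribution law,
-- and (3), (4) rearrange both sides into a common tagged normal form.

open import Level using (0ℓ)
open import Data.Product using (_×_; _,_)
open import Relation.Binary.Bundles using (Setoid)
import Relation.Binary.Reasoning.Setoid as SetoidReasoning

open import Defs

≈-setoid : Setoid 0ℓ 0ℓ
≈-setoid = record
  { Carrier       = Term
  ; _≈_           = _≈_
  ; isEquivalence = record { refl = refl′ ; sym = sym′ ; trans = trans′ }
  }

open SetoidReasoning ≈-setoid using (begin_; step-≈-⟩; step-≈-⟨; _∎)

∧-congˡ : ∀ {a b b′} → b ≈ b′ → a ∧◦ b ≈ a ∧◦ b′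
∧-congˡ = cong∧ refl′

∧-congʳ : ∀ {a a′ b} → a ≈ a′ → a ∧◦ b ≈ a′ ∧◦ b
∧-congʳ p = cong∧ p refl′

∨-congˡ : ∀ {a b b′} → b ≈ b′ → a ∨◦ b ≈ a ∨◦ b′
∨-congˡ = cong∨ refl′

∨-congʳ : ∀ {a a′ b} → a ≈ a′ → a ∨◦ b ≈ a′ ∨◦ b
∨-congʳ p = cong∨ p refl′

¬F≈T : ¬ F ≈ T
¬F≈T = trans′ (cong¬ ax1) (ax3 T)

¬-∨ : ∀ a b → ¬ (a ∨◦ b) ≈ ¬ a ∧◦ ¬ b
¬-∨ a b = trans′ (cong¬ (ax2 a b)) (ax3 _)

¬-∧ : ∀ a b → ¬ (a ∧◦ b) ≈ ¬ a ∨◦ ¬ b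
¬-∧ a b = begin
  ¬ (a ∧◦ b)           ≈⟨ cong¬ (cong∧ (ax3 a) (ax3 b)) ⟨
  ¬ (¬ ¬ a ∧◦ ¬ ¬ b)   ≈⟨ ax2 (¬ a) (¬ b) ⟨
  ¬ a ∨◦ ¬ b           ∎

-- ∨◦ is associative, being the De Morgan dual of the associative ∧◦.
∨-assoc : ∀ a b c → (a ∨◦ b) ∨◦ c ≈ a ∨◦ (b ∨◦ c)
∨-assoc a b c = begin
  (a ∨◦ b) ∨◦ c             ≈⟨ ax2 _ _ ⟩
  ¬ (¬ (a ∨◦ b) ∧◦ ¬ c)     ≈⟨ cong¬ (∧-congʳ (¬-∨ a b)) ⟩
  ¬ ((¬ a ∧◦ ¬ b) ∧◦ ¬ c)   ≈⟨ cong¬ (ax4 _ _ _) ⟩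
  ¬ (¬ a ∧◦ (¬ b ∧◦ ¬ c))   ≈⟨ cong¬ (∧-congˡ (¬-∨ b c)) ⟨
  ¬ (¬ a ∧◦ ¬ (b ∨◦ c))     ≈⟨ ax2 _ _ ⟨
  a ∨◦ (b ∨◦ c)             ∎

-- T is left-absorbing for ∨◦ (dual of axiom 7).
T-∨ : ∀ a → T ∨◦ a ≈ T
T-∨ a = begin
  T ∨◦ a              ≈⟨ ax2 T a ⟩
  ¬ (¬ T ∧◦ ¬ a)      ≈⟨ cong¬ (∧-congʳ ax1) ⟨
  ¬ (F ∧◦ ¬ a)        ≈⟨ cong¬ (ax7 _) ⟩
  ¬ F                 ≈⟨ ¬F≈T ⟩
  T                   ∎

¬-∧F : ∀ a → ¬ (a ∧◦ F) ≈ a ∨◦ T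
¬-∧F a = begin
  ¬ (a ∧◦ F)          ≈⟨ cong¬ (ax8 a) ⟩
  ¬ (¬ a ∧◦ F)        ≈⟨ cong¬ (∧-congˡ ax1) ⟩
  ¬ (¬ a ∧◦ ¬ T)      ≈⟨ ax2 a T ⟨
  a ∨◦ T              ∎

¬-∨T : ∀ a → ¬ (a ∨◦ T) ≈ a ∧◦ F
¬-∨T a = trans′ (cong¬ (sym′ (¬-∧F a))) (ax3 _)

∧F-absorbs : ∀ a b → (a ∧◦ F) ∧◦ b ≈ a ∧◦ F
∧F-absorbs a b = trans′ (ax4 a F b) (∧-congˡ (ax7 b))

∨T-absorbs : ∀ a b → (a ∨◦ T) ∨◦ b ≈ a ∨◦ T
∨T-absorbs a b = trans′ (∨-assoc a T b) (∨-congˡ (T-∨ b))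

∨T-∧F : ∀ a → (a ∨◦ T) ∧◦ F ≈ a ∧◦ F
∨T-∧F a = begin
  (a ∨◦ T) ∧◦ F       ≈⟨ ax8 _ ⟩
  ¬ (a ∨◦ T) ∧◦ F     ≈⟨ ∧-congʳ (¬-∨T a) ⟩
  (a ∧◦ F) ∧◦ F       ≈⟨ ∧F-absorbs a F ⟩
  a ∧◦ F              ∎

∧F-∨T : ∀ a → (a ∧◦ F) ∨◦ T ≈ a ∨◦ T
∧F-∨T a = trans′ (ax9 a T) (ax6 _)

-- Dual of axiom 10: ∧◦ distributes over ∨◦ towards a T-tagged right argument.
∧-distribʳ-∨T : ∀ a b c →
  (a ∨◦ b) ∧◦ (c ∨◦ T) ≈ (a ∧◦ (c ∨◦ T)) ∨◦ (b ∧◦ (c ∨◦ T))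
∧-distribʳ-∨T a b c = begin
  (a ∨◦ b) ∧◦ (c ∨◦ T)                             ≈⟨ ax3 _ ⟨
  ¬ ¬ ((a ∨◦ b) ∧◦ (c ∨◦ T))                       ≈⟨ cong¬ (¬-∧ _ _) ⟩
  ¬ (¬ (a ∨◦ b) ∨◦ ¬ (c ∨◦ T))                     ≈⟨ cong¬ (cong∨ (¬-∨ a b) (¬-∨T c)) ⟩
  ¬ ((¬ a ∧◦ ¬ b) ∨◦ (c ∧◦ F))                     ≈⟨ cong¬ (ax10 _ _ _) ⟩
  ¬ ((¬ a ∨◦ (c ∧◦ F)) ∧◦ (¬ b ∨◦ (c ∧◦ F)))       ≈⟨ ¬-∧ _ _ ⟩
  ¬ (¬ a ∨◦ (c ∧◦ F)) ∨◦ ¬ (¬ b ∨◦ (c ∧◦ F))       ≈⟨ cong∨ (undo a) (undo b) ⟩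
  (a ∧◦ (c ∨◦ T)) ∨◦ (b ∧◦ (c ∨◦ T))               ∎
  where
  undo : ∀ d → ¬ (¬ d ∨◦ (c ∧◦ F)) ≈ d ∧◦ (c ∨◦ T)
  undo d = trans′ (¬-∨ _ _) (cong∧ (ax3 d) (¬-∧F c))

-- F-tagging a disjunction: a is evaluated, and if it fails b is too.
-- This is the basic fact behind a final F, where only side effects matter.
∨-∧F : ∀ a b → (a ∨◦ b) ∧◦ F ≈ ¬ a ∧◦ (b ∧◦ F)
∨-∧F a b = begin
  (a ∨◦ b) ∧◦ F       ≈⟨ ax8 _ ⟩
  ¬ (a ∨◦ b) ∧◦ F     ≈⟨ ∧-congʳ (¬-∨ a b) ⟩
  (¬ a ∧◦ ¬ b) ∧◦ F   ≈⟨ ax4 _ _ _ ⟩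
  ¬ a ∧◦ (¬ b ∧◦ F)   ≈⟨ ∧-congˡ (ax8 b) ⟨
  ¬ a ∧◦ (b ∧◦ F)     ∎

∨-congˡ-∧F : ∀ a {b b′} → b ∧◦ F ≈ b′ ∧◦ F → (a ∨◦ b) ∧◦ F ≈ (a ∨◦ b′) ∧◦ F
∨-congˡ-∧F a {b} {b′} p = begin
  (a ∨◦ b) ∧◦ F       ≈⟨ ∨-∧F a b ⟩
  ¬ a ∧◦ (b ∧◦ F)     ≈⟨ ∧-congˡ p ⟩
  ¬ a ∧◦ (b′ ∧◦ F)    ≈⟨ ∨-∧F a b′ ⟨
  (a ∨◦ b′) ∧◦ F      ∎

∧-∨T-∧F : ∀ a b → (a ∧◦ (b ∨◦ T)) ∧◦ F ≈ (a ∧◦ b) ∧◦ F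
∧-∨T-∧F a b = begin
  (a ∧◦ (b ∨◦ T)) ∧◦ F    ≈⟨ ax4 _ _ _ ⟩
  a ∧◦ ((b ∨◦ T) ∧◦ F)    ≈⟨ ∧-congˡ (∨T-∧F b) ⟩
  a ∧◦ (b ∧◦ F)           ≈⟨ ax4 _ _ _ ⟨
  (a ∧◦ b) ∧◦ F           ∎

∨∧F-swap : ∀ a e w →
  (a ∨◦ (e ∧◦ F)) ∧◦ (w ∧◦ F) ≈ (¬ a ∨◦ (w ∧◦ F)) ∧◦ (e ∧◦ F)
∨∧F-swap a e w = begin
  (a ∨◦ (e ∧◦ F)) ∧◦ (w ∧◦ F)                       ≈⟨ ax4 _ _ _ ⟨
  ((a ∨◦ (e ∧◦ F)) ∧◦ w) ∧◦ F                       ≈⟨ ax8 _ ⟩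
  ¬ ((a ∨◦ (e ∧◦ F)) ∧◦ w) ∧◦ F                     ≈⟨ ∧-congʳ (¬-∧ _ _) ⟩
  (¬ (a ∨◦ (e ∧◦ F)) ∨◦ ¬ w) ∧◦ F                   ≈⟨ ∧-congʳ (∨-congʳ ¬disjunct) ⟩
  ((¬ a ∧◦ (e ∨◦ T)) ∨◦ ¬ w) ∧◦ F                   ≈⟨ ∨-congˡ-∧F _ sameEffects ⟩
  ((¬ a ∧◦ (e ∨◦ T)) ∨◦ (w ∧◦ F)) ∧◦ F              ≈⟨ ∧-congʳ (ax10 _ _ _) ⟩
  ((¬ a ∨◦ (w ∧◦ F)) ∧◦ ((e ∨◦ T) ∨◦ (w ∧◦ F))) ∧◦ F ≈⟨ ∧-congʳ (∧-congˡ (∨T-absorbs e _)) ⟩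
  ((¬ a ∨◦ (w ∧◦ F)) ∧◦ (e ∨◦ T)) ∧◦ F              ≈⟨ ∧-∨T-∧F _ e ⟩
  ((¬ a ∨◦ (w ∧◦ F)) ∧◦ e) ∧◦ F                     ≈⟨ ax4 _ _ _ ⟩
  (¬ a ∨◦ (w ∧◦ F)) ∧◦ (e ∧◦ F)                     ∎
  where
  ¬disjunct : ¬ (a ∨◦ (e ∧◦ F)) ≈ ¬ a ∧◦ (e ∨◦ T)
  ¬disjunct = trans′ (¬-∨ _ _) (∧-congˡ (¬-∧F e))

  -- ¬ w and w ∧◦ F both just evaluate w.
  sameEffects : ¬ w ∧◦ F ≈ (w ∧◦ F) ∧◦ F
  sameEffects = trans′ (sym′ (ax8 w)) (sym′ (∧F-absorbs w F))

equation1 : ∀ x y → (x ∨◦ T) ∧◦ ¬ y ≈ ¬ ((x ∨◦ T) ∧◦ y)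
equation1 x y = begin
  (x ∨◦ T) ∧◦ ¬ y          ≈⟨ ax9 _ _ ⟨
  (x ∧◦ F) ∨◦ ¬ y          ≈⟨ ax2 _ _ ⟩
  ¬ (¬ (x ∧◦ F) ∧◦ ¬ ¬ y)  ≈⟨ cong¬ (cong∧ (¬-∧F x) (ax3 y)) ⟩
  ¬ ((x ∨◦ T) ∧◦ y)        ∎

equation2 : ∀ x y z w →
  (x ∧◦ (y ∧◦ (z ∨◦ T))) ∨◦ (w ∧◦ (z ∨◦ T)) ≈ ((x ∧◦ y) ∨◦ w) ∧◦ (z ∨◦ T)
equation2 x y z w = begin
  (x ∧◦ (y ∧◦ (z ∨◦ T))) ∨◦ (w ∧◦ (z ∨◦ T))  ≈⟨ ∨-congʳ (ax4 _ _ _) ⟨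
  ((x ∧◦ y) ∧◦ (z ∨◦ T)) ∨◦ (w ∧◦ (z ∨◦ T))  ≈⟨ ∧-distribʳ-∨T _ _ _ ⟨
  ((x ∧◦ y) ∨◦ w) ∧◦ (z ∨◦ T)                ∎

-- Both sides become the T-tagged term ((x ∨◦ (y ∧◦ F)) ∧◦ w) ∨◦ T
-- followed by the F-tagged z.
equation3 : ∀ x y z w →
  (x ∨◦ ((y ∨◦ T) ∧◦ (z ∧◦ F))) ∧◦ ((w ∨◦ T) ∧◦ (z ∧◦ F))
    ≈ ((x ∧◦ (w ∨◦ T)) ∨◦ (y ∨◦ T)) ∧◦ (z ∧◦ F)
equation3 x y z w = begin
  (x ∨◦ ((y ∨◦ T) ∧◦ c)) ∧◦ ((w ∨◦ T) ∧◦ c)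
    ≈⟨ cong∧ (∨-congˡ (ax9 _ _)) (ax9 _ _) ⟨
  (x ∨◦ ((y ∧◦ F) ∨◦ c)) ∧◦ ((w ∧◦ F) ∨◦ c)        ≈⟨ ∧-congʳ (∨-assoc _ _ _) ⟨
  ((x ∨◦ (y ∧◦ F)) ∨◦ c) ∧◦ ((w ∧◦ F) ∨◦ c)        ≈⟨ ax10 _ _ _ ⟨
  ((x ∨◦ (y ∧◦ F)) ∧◦ (w ∧◦ F)) ∨◦ c               ≈⟨ ∨-congʳ (ax4 _ _ _) ⟨
  (((x ∨◦ (y ∧◦ F)) ∧◦ w) ∧◦ F) ∨◦ c               ≈⟨ ax9 _ _ ⟩
  (((x ∨◦ (y ∧◦ F)) ∧◦ w) ∨◦ T) ∧◦ c               ≈⟨ ∧-congʳ sideEffects ⟩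
  ((x ∧◦ (w ∨◦ T)) ∨◦ (y ∨◦ T)) ∧◦ c               ∎
  where
  c : Term
  c = z ∧◦ F

  sideEffects : ((x ∨◦ (y ∧◦ F)) ∧◦ w) ∨◦ T ≈ (x ∧◦ (w ∨◦ T)) ∨◦ (y ∨◦ T)
  sideEffects = begin
    ((x ∨◦ (y ∧◦ F)) ∧◦ w) ∨◦ T                ≈⟨ ¬-∧F _ ⟨
    ¬ (((x ∨◦ (y ∧◦ F)) ∧◦ w) ∧◦ F)            ≈⟨ cong¬ (∧-∨T-∧F _ w) ⟨
    ¬ (((x ∨◦ (y ∧◦ F)) ∧◦ (w ∨◦ T)) ∧◦ F)     ≈⟨ ¬-∧F _ ⟩
    ((x ∨◦ (y ∧◦ F)) ∧◦ (w ∨◦ T)) ∨◦ T         ≈⟨ ∨-congʳ (∧-distribʳ-∨T _ _ _) ⟩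
    ((x ∧◦ (w ∨◦ T)) ∨◦ ((y ∧◦ F) ∧◦ (w ∨◦ T))) ∨◦ T
      ≈⟨ ∨-congʳ (∨-congˡ (∧F-absorbs y _)) ⟩
    ((x ∧◦ (w ∨◦ T)) ∨◦ (y ∧◦ F)) ∨◦ T         ≈⟨ ∨-assoc _ _ _ ⟩
    (x ∧◦ (w ∨◦ T)) ∨◦ ((y ∧◦ F) ∨◦ T)         ≈⟨ ∨-congˡ (∧F-∨T y) ⟩
    (x ∧◦ (w ∨◦ T)) ∨◦ (y ∨◦ T)                ∎

-- Swap the F-tags of z and w, then split off the T-tagged y.
equation4 : ∀ x y z w →
  (x ∨◦ ((y ∨◦ T) ∧◦ (z ∧◦ F))) ∧◦ (w ∧◦ F)
    ≈ ((¬ x ∧◦ (y ∨◦ T)) ∨◦ (w ∧◦ F)) ∧◦ (z ∧◦ F)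
equation4 x y z w = begin
  (x ∨◦ ((y ∨◦ T) ∧◦ (z ∧◦ F))) ∧◦ (w ∧◦ F)      ≈⟨ ∧-congʳ (∨-congˡ (ax4 _ _ _)) ⟨
  (x ∨◦ (((y ∨◦ T) ∧◦ z) ∧◦ F)) ∧◦ (w ∧◦ F)      ≈⟨ ∨∧F-swap _ _ _ ⟩
  (¬ x ∨◦ (w ∧◦ F)) ∧◦ (((y ∨◦ T) ∧◦ z) ∧◦ F)    ≈⟨ ∧-congˡ (ax4 _ _ _) ⟩
  (¬ x ∨◦ (w ∧◦ F)) ∧◦ ((y ∨◦ T) ∧◦ (z ∧◦ F))    ≈⟨ ax4 _ _ _ ⟨
  ((¬ x ∨◦ (w ∧◦ F)) ∧◦ (y ∨◦ T)) ∧◦ (z ∧◦ F)    ≈⟨ ∧-congʳ (∧-congˡ (∨T-absorbs y _)) ⟨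
  ((¬ x ∨◦ (w ∧◦ F)) ∧◦ ((y ∨◦ T) ∨◦ (w ∧◦ F))) ∧◦ (z ∧◦ F)
    ≈⟨ ∧-congʳ (ax10 _ _ _) ⟨
  ((¬ x ∧◦ (y ∨◦ T)) ∨◦ (w ∧◦ F)) ∧◦ (z ∧◦ F)    ∎

mainTheorem19 : (x y z w : Term) →
    ((x ∨◦ T) ∧◦ ¬ y ≈ ¬ ((x ∨◦ T) ∧◦ y))
    × ((x ∧◦ (y ∧◦ (z ∨◦ T))) ∨◦ (w ∧◦ (z ∨◦ T)) ≈ ((x ∧◦ y) ∨◦ w) ∧◦ (z ∨◦ T))
    × ((x ∨◦ ((y ∨◦ T) ∧◦ (z ∧◦ F))) ∧◦ ((w ∨◦ T) ∧◦ (z ∧◦ F))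
    ≈ ((x ∧◦ (w ∨◦ T)) ∨◦ (y ∨◦ T)) ∧◦ (z ∧◦ F))
    × ((x ∨◦ ((y ∨◦ T) ∧◦ (z ∧◦ F))) ∧◦ (w ∧◦ F)
    ≈ ((¬ x ∧◦ (y ∨◦ T)) ∨◦ (w ∧◦ F)) ∧◦ (z ∧◦ F))
mainTheorem19 x y z w =
  equation1 x y , equation2 x y z w , equation3 x y z w , equation4 x y z w
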